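{- Let $T$ be an almost regular tournament of order $2d$. For every $v\in V(T)$, $d^{++}(v)-d^+(v)=1$ if $v$ is a 2-king of $T$ and $d^-(v)=d$; $d^{++}(v)-d^+(v)=-1$ if $d^+(v)=d$; and $d^{++}(v)-d^+(v)=0$ otherwise.
   Context: A tournament $T$ is almost regular if $|d^+(x)-d^-(x)|=1$ for every vertex $x$, where $d^+(x)=|N^+(x)|$, $d^-(x)=|N^-(x)|$. $N^{++}(v)=\{u: vw,wu\in A(T)\text{ for some } w\}\setminus N^+(v)$ and $d^{++}(v)=|N^{++}(v)|$. A vertex $v$ is a 2-king of $T$ if $V(T)=\{v\}\cup N^+(v)\cup N^{++}(v)$. -}

module Defs where

open import Data.Nat using (ℕ)
open import Data.Bool using (Bool; true; false; _∧_; not)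
open import Data.Fin using (Fin)
open import Data.Fin.Subset using (Subset; ∣_∣)
open import Data.Vec using (tabulate)
open import Data.List using (allFin)
open import Data.Bool.ListAction using (any)
open import Data.Integer using (ℤ; +_; _-_; ∣_∣)
open import Data.Product using (_×_)
open import Data.Sum using (_⊎_)
open import Relation.Binary.PropositionalEquality using (_≡_; _≢_)

-- A tournament on vertex set Fin n: adj x y ≡ true iff the arc x→y is in A(T).
-- No loops, and between any two distinct vertices exactly one arc.
record Tournament (n : ℕ) : Set where
  field
    adj   : Fin n → Fin n → Bool
    irrefl : ∀ x → adj x x ≡ false
    tour  : ∀ x y → x ≢ y →
            (adj x y ≡ true × adj y x ≡ false) ⊎ (adj x y ≡ false × adj y x ≡ true)
open Tournament public

module _ {n : ℕ} (T : Tournament n) where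

  inN⁺ : Fin n → Fin n → Bool
  inN⁺ v u = adj T v u

  inN⁻ : Fin n → Fin n → Bool
  inN⁻ v u = adj T u v

  inN⁺⁺ : Fin n → Fin n → Bool
  inN⁺⁺ v u = any (λ w → adj T v w ∧ adj T w u) (allFin n) ∧ not (adj T v u)

  N⁺ N⁻ N⁺⁺ : Fin n → Subset n
  N⁺ v = tabulate (inN⁺ v)
  N⁻ v = tabulate (inN⁻ v)
  N⁺⁺ v = tabulate (inN⁺⁺ v)

  d⁺ d⁻ d⁺⁺ : Fin n → ℕ
  d⁺ v = Data.Fin.Subset.∣ N⁺ v ∣
  d⁻ v = Data.Fin.Subset.∣ N⁻ v ∣
  d⁺⁺ v = Data.Fin.Subset.∣ N⁺⁺ v ∣

  AlmostRegular : Set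
  AlmostRegular = ∀ x → Data.Integer.∣ + d⁺ x - + d⁻ x ∣ ≡ 1

  TwoKing : Fin n → Set
  TwoKing v = ∀ u → u ≡ v ⊎ inN⁺ v u ≡ true ⊎ inN⁺⁺ v u ≡ true

  gap : Fin n → ℤ
  gap v = + d⁺⁺ v - + d⁺ v

{-# OPTIONS --safe #-}
-- Every vertex u of N⁻(v) ∖ N⁺⁺(v) beats all of {v} ∪ N⁺(v), so d⁺(u) > d⁺(v), and if u → u′
-- for two such vertices then d⁺(u) > d⁺(v) + 1. In an almost regular tournament of order 2d
-- every out-degree is d or d − 1, hence N⁻(v) ∖ N⁺⁺(v) is empty when d⁺(v) = d and has at most
-- one element when d⁻(v) = d; it is empty exactly when v is a 2-king. As N⁺⁺(v) ⊆ N⁻(v), the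
-- three values of d⁺⁺(v) − d⁺(v) follow from d⁻(v) = d⁺⁺(v) + |N⁻(v) ∖ N⁺⁺(v)|.

module Submission where

open import Defs
open import Data.Bool using (Bool; true; false; _∧_; _∨_; not)
open import Data.Bool.Properties using (not-¬; not-injective; ∧-conicalˡ; ∧-conicalʳ; ∧-identityʳ; ∧-zeroʳ; T-≡; T-not-≡)
open import Data.Empty using (⊥-elim)
open import Data.Fin using (Fin; zero; suc)
open import Data.Fin.Properties using (_≟_; 0≢1+n)
import Data.Fin.Properties as Fin
open import Data.Fin.Subset using (∣_∣)
open import Data.Integer using (+_; -[1+_]; _-_; _⊖_)
import Data.Integer as ℤ
open import Data.Integer.Properties using (m-n≡m⊖n; [1+m]⊖[1+n]≡m⊖n; n⊖n≡0)
open import Data.List using (allFin)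
open import Data.Bool.ListAction using (any)
open import Data.List.Membership.Propositional.Properties using (∈-allFin)
open import Data.List.Relation.Unary.Any using (satisfied)
import Data.List.Relation.Unary.Any as Any
open import Data.List.Relation.Unary.Any.Properties using (any⁺; any⁻)
open import Data.Nat using (ℕ; zero; suc; _+_; _*_; _≤_; _<_; z≤n; s≤s)
open import Data.Nat.Properties
  using (+-suc; +-comm; ≤-antisym; n≢0⇒n>0; suc-injective; +-identityʳ; +-cancelˡ-≡; *-cancelˡ-≡; ≤-trans; ≤-reflexive; n≤1+n; m≤n⇒m≤1+n; <-irrefl)
open import Data.Product using (_×_; _,_; proj₁; ∃-syntax)
open import Data.Sum using (_⊎_; inj₁; inj₂; [_,_])
open import Data.Vec.Properties using (tabulate-cong)
open import Data.Vec using (tabulate)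
open import Function using (_∘_)
open import Function.Bundles using (_⇔_; mk⇔; Equivalence)
open import Relation.Nullary using (¬_; yes; no; does)
open import Relation.Nullary.Decidable using (dec-false)
open import Relation.Binary.PropositionalEquality
  using (_≡_; _≢_; _≗_; refl; sym; trans; cong; cong₂; subst; module ≡-Reasoning)

∣m⊖n∣≡1⇒m≡1+n⊎n≡1+m : ∀ m n → ℤ.∣ m ⊖ n ∣ ≡ 1 → m ≡ suc n ⊎ n ≡ suc m
∣m⊖n∣≡1⇒m≡1+n⊎n≡1+m zero          (suc zero)    _ = inj₂ refl
∣m⊖n∣≡1⇒m≡1+n⊎n≡1+m (suc zero)    zero          _ = inj₁ refl
∣m⊖n∣≡1⇒m≡1+n⊎n≡1+m (suc m)       (suc n)       e
  with ∣m⊖n∣≡1⇒m≡1+n⊎n≡1+m m n (trans (cong ℤ.∣_∣ (sym ([1+m]⊖[1+n]≡m⊖n m n))) e)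
... | inj₁ m≡1+n = inj₁ (cong suc m≡1+n)
... | inj₂ n≡1+m = inj₂ (cong suc n≡1+m)

1+m⊖m≡1 : ∀ m → suc m ⊖ m ≡ + 1
1+m⊖m≡1 zero    = refl
1+m⊖m≡1 (suc m) = trans ([1+m]⊖[1+n]≡m⊖n (suc m) m) (1+m⊖m≡1 m)

m⊖1+m≡-1 : ∀ m → m ⊖ suc m ≡ -[1+ 0 ]
m⊖1+m≡-1 zero    = refl
m⊖1+m≡-1 (suc m) = trans ([1+m]⊖[1+n]≡m⊖n m (suc m)) (m⊖1+m≡-1 m)

m+m≡2*n⇒m≡n : ∀ {m n} → m + m ≡ 2 * n → m ≡ n
m+m≡2*n⇒m≡n {m} {n} e = *-cancelˡ-≡ m n 2 (trans (cong (_+_ m) (+-identityʳ m)) e)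

1+m+n≡2*d⇒m≡d⇒1+n≡d : ∀ {m n d} → suc (m + n) ≡ 2 * d → m ≡ d → suc n ≡ d
1+m+n≡2*d⇒m≡d⇒1+n≡d {n = n} {d} e refl = +-cancelˡ-≡ d (suc n) d (begin
  d + suc n   ≡⟨ +-suc d n ⟩
  suc (d + n) ≡⟨ e ⟩
  2 * d       ≡⟨ cong (_+_ d) (+-identityʳ d) ⟩
  d + d       ∎)
  where open ≡-Reasoning

|m-n|≡1⇒m≡d⊎n≡d : ∀ {m n d} → ℤ.∣ + m - + n ∣ ≡ 1 → suc (m + n) ≡ 2 * d → m ≡ d ⊎ n ≡ d
|m-n|≡1⇒m≡d⊎n≡d {m} {n} diff sum
  with ∣m⊖n∣≡1⇒m≡1+n⊎n≡1+m m n (trans (cong ℤ.∣_∣ (sym (m-n≡m⊖n m n))) diff)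
... | inj₁ refl = inj₁ (m+m≡2*n⇒m≡n (trans (+-suc (suc n) n) sum))
... | inj₂ refl = inj₂ (m+m≡2*n⇒m≡n sum)

count : ∀ {n} → (Fin n → Bool) → ℕ
count f = ∣ tabulate f ∣

count-cong : ∀ {n} {f g : Fin n → Bool} → f ≗ g → count f ≡ count g
count-cong f≗g = cong ∣_∣ (tabulate-cong f≗g)

count-∨ : ∀ {n} {f g : Fin n → Bool} → (∀ x → f x ∧ g x ≡ false) → count (λ x → f x ∨ g x) ≡ count f + count g
count-∨ {n = zero} _ = refl
count-∨ {n = suc n} {f} {g} disjoint
  with f zero | g zero | disjoint zero | count-∨ {f = f ∘ suc} {g = g ∘ suc} (disjoint ∘ suc)
... | true  | true  | () | _
... | true  | false | _  | ih = cong suc ih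
... | false | true  | _  | ih = trans (cong suc ih) (sym (+-suc _ _))
... | false | false | _  | ih = ih

count-mono : ∀ {n} {f g : Fin n → Bool} → (∀ x → f x ≡ true → g x ≡ true) → count f ≤ count g
count-mono {n = zero} _ = z≤n
count-mono {n = suc n} {f} {g} f⊆g
  with f zero | g zero | f⊆g zero | count-mono {f = f ∘ suc} {g = g ∘ suc} (f⊆g ∘ suc)
... | true  | true  | _  | ih = s≤s ih
... | true  | false | f0 | _  with f0 refl
... | ()
count-mono {n = suc n} _ | false | true  | _ | ih = m≤n⇒m≤1+n ih
count-mono {n = suc n} _ | false | false | _ | ih = ih

count-false : ∀ {n} {f : Fin n → Bool} → (∀ x → f x ≡ false) → count f ≡ 0
count-false {n = zero} _ = refl
count-false {n = suc n} {f} f≡false rewrite f≡false zero = count-false (f≡false ∘ suc)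

count≡0⇒false : ∀ {n} {f : Fin n → Bool} → count f ≡ 0 → ∀ x → f x ≡ false
count≡0⇒false {n = suc n} {f} e x with f zero in f0
count≡0⇒false {n = suc n} {f} () x | true
count≡0⇒false {n = suc n} {f} e zero    | false = f0
count≡0⇒false {n = suc n} {f} e (suc x) | false = count≡0⇒false e x

count-true : ∀ {n} {f : Fin n → Bool} → (∀ x → f x ≡ true) → count f ≡ n
count-true {n = zero} _ = refl
count-true {n = suc n} {f} f≡true rewrite f≡true zero = cong suc (count-true (f≡true ∘ suc))

count≤1 : ∀ {n} {f : Fin n → Bool} → (∀ x y → f x ≡ true → f y ≡ true → x ≡ y) → count f ≤ 1
count≤1 {n = zero} _ = z≤n
count≤1 {n = suc n} {f} unique with f zero in f0
... | true  = s≤s (≤-reflexive (count-false rest-false))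
  where
  rest-false : ∀ x → f (suc x) ≡ false
  rest-false x with f (suc x) in fx
  ... | false = refl
  ... | true  = ⊥-elim (0≢1+n (unique zero (suc x) f0 fx))
... | false = count≤1 λ x y fx fy → Fin.suc-injective (unique (suc x) (suc y) fx fy)

count-point : ∀ {n} (w : Fin n) → count (λ x → does (x ≟ w)) ≡ 1
count-point {suc n} zero = cong suc (count-false {n} λ _ → refl)
count-point (suc w)      = count-point w

count-insert : ∀ {n} {f : Fin n → Bool} (w : Fin n) → f w ≡ false →
               count (λ x → does (x ≟ w) ∨ f x) ≡ suc (count f)
count-insert {f = f} w fw = trans (count-∨ disjoint) (cong (_+ count f) (count-point w))
  where
  disjoint : ∀ x → does (x ≟ w) ∧ f x ≡ false
  disjoint x with x ≟ w
  ... | yes refl = fw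
  ... | no _     = refl

module _ {n : ℕ} (T : Tournament n) where

  adj-asym : ∀ {x y} → adj T x y ≡ true → adj T y x ≡ false
  adj-asym {x} {y} xy with x ≟ y
  ... | yes refl = ⊥-elim (not-¬ (irrefl T x) xy)
  ... | no x≢y with tour T x y x≢y
  ... | inj₁ (_ , yx)  = yx
  ... | inj₂ (¬xy , _) = ⊥-elim (not-¬ ¬xy xy)

  adj-total : ∀ {x y} → x ≢ y → adj T x y ≡ false → adj T y x ≡ true
  adj-total {x} {y} x≢y ¬xy with tour T x y x≢y
  ... | inj₁ (xy , _) = ⊥-elim (not-¬ ¬xy xy)
  ... | inj₂ (_ , yx) = yx

  inN⁺[_] : Fin n → Fin n → Bool
  inN⁺[ v ] w = does (w ≟ v) ∨ inN⁺ T v w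

  count-N⁺[_] : ∀ v → count inN⁺[ v ] ≡ suc (d⁺ T v)
  count-N⁺[ v ] = count-insert v (irrefl T v)

  1+d⁺+d⁻≡n : ∀ v → suc (d⁺ T v + d⁻ T v) ≡ n
  1+d⁺+d⁻≡n v = begin
    suc (d⁺ T v + d⁻ T v)                                     ≡⟨ cong suc (count-∨ N⁺∩N⁻≡∅) ⟨
    suc (count λ u → inN⁺ T v u ∨ inN⁻ T v u)                 ≡⟨ count-insert v v∉N⁺∪N⁻ ⟨
    count (λ u → does (u ≟ v) ∨ (inN⁺ T v u ∨ inN⁻ T v u))   ≡⟨ count-true covers ⟩
    n                                                         ∎
    where
    open ≡-Reasoning
    N⁺∩N⁻≡∅ : ∀ u → inN⁺ T v u ∧ inN⁻ T v u ≡ false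
    N⁺∩N⁻≡∅ u with adj T v u in vu
    ... | true  = adj-asym vu
    ... | false = refl
    v∉N⁺∪N⁻ : inN⁺ T v v ∨ inN⁻ T v v ≡ false
    v∉N⁺∪N⁻ rewrite irrefl T v = refl
    covers : ∀ u → does (u ≟ v) ∨ (inN⁺ T v u ∨ inN⁻ T v u) ≡ true
    covers u with u ≟ v
    ... | yes _   = refl
    ... | no u≢v with adj T v u in vu
    ... | true  = refl
    ... | false = adj-total (u≢v ∘ sym) vu

  inN⁺⁺⁻ : ∀ {v u} → inN⁺⁺ T v u ≡ true →
           (∃[ w ] adj T v w ≡ true × adj T w u ≡ true) × adj T v u ≡ false
  inN⁺⁺⁻ {v} {u} e = two-path , Equivalence.to T-not-≡ (Equivalence.from T-≡ (∧-conicalʳ _ _ e))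
    where
    two-path : ∃[ w ] adj T v w ≡ true × adj T w u ≡ true
    two-path with satisfied (any⁻ _ (allFin n) (Equivalence.from T-≡ (∧-conicalˡ _ _ e)))
    ... | w , vwu = let vwu≡true = Equivalence.to T-≡ vwu
                    in w , ∧-conicalˡ _ _ vwu≡true , ∧-conicalʳ _ _ vwu≡true

  inN⁺⁺⁺ : ∀ {v w u} → adj T v w ≡ true → adj T w u ≡ true → adj T v u ≡ false → inN⁺⁺ T v u ≡ true
  inN⁺⁺⁺ {v} {w} {u} vw wu vu = cong₂ _∧_ reached (cong not vu)
    where
    reached : any (λ x → adj T v x ∧ adj T x u) (allFin n) ≡ true
    reached = Equivalence.to T-≡ (any⁺ _ (Any.map (λ { refl → Equivalence.from T-≡ (cong₂ _∧_ vw wu) }) (∈-allFin w)))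

  N⁺⁺⊆N⁻ : ∀ {v u} → inN⁺⁺ T v u ≡ true → inN⁻ T v u ≡ true
  N⁺⁺⊆N⁻ {v} {u} e with inN⁺⁺⁻ e
  ... | (w , vw , wu) , vu = adj-total v≢u vu
    where
    v≢u : v ≢ u
    v≢u refl = not-¬ (adj-asym vw) wu

  inN⁻∖N⁺⁺ : Fin n → Fin n → Bool
  inN⁻∖N⁺⁺ v u = inN⁻ T v u ∧ not (inN⁺⁺ T v u)

  inN⁻∖N⁺⁺⁻ : ∀ {v u} → inN⁻∖N⁺⁺ v u ≡ true → adj T u v ≡ true × inN⁺⁺ T v u ≡ false
  inN⁻∖N⁺⁺⁻ e = ∧-conicalˡ _ _ e , Equivalence.to T-not-≡ (Equivalence.from T-≡ (∧-conicalʳ _ _ e))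

  d⁻≡d⁺⁺+|N⁻∖N⁺⁺| : ∀ v → d⁻ T v ≡ d⁺⁺ T v + count (inN⁻∖N⁺⁺ v)
  d⁻≡d⁺⁺+|N⁻∖N⁺⁺| v = trans (count-cong N⁻≡N⁺⁺∪N⁻∖N⁺⁺) (count-∨ disjoint)
    where
    N⁻≡N⁺⁺∪N⁻∖N⁺⁺ : ∀ u → inN⁻ T v u ≡ inN⁺⁺ T v u ∨ inN⁻∖N⁺⁺ v u
    N⁻≡N⁺⁺∪N⁻∖N⁺⁺ u with inN⁺⁺ T v u in e
    ... | true  = N⁺⁺⊆N⁻ e
    ... | false = sym (∧-identityʳ _)
    disjoint : ∀ u → inN⁺⁺ T v u ∧ inN⁻∖N⁺⁺ v u ≡ false
    disjoint u with inN⁺⁺ T v u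
    ... | true  = ∧-zeroʳ _
    ... | false = refl

  N⁻∖N⁺⁺-dominates-N⁺[_] : ∀ v {u w} → inN⁻∖N⁺⁺ v u ≡ true → inN⁺[ v ] w ≡ true → adj T u w ≡ true
  N⁻∖N⁺⁺-dominates-N⁺[ v ] {u} {w} e w∈N⁺[v] with inN⁻∖N⁺⁺⁻ e | w ≟ v
  ... | uv , _  | yes refl = uv
  ... | uv , u∉N⁺⁺ | no _ with adj T u w in uw
  ... | true  = refl
  ... | false = ⊥-elim (not-¬ u∉N⁺⁺ (inN⁺⁺⁺ w∈N⁺[v] (adj-total u≢w uw) (adj-asym uv)))
    where
    u≢w : u ≢ w
    u≢w refl = not-¬ (adj-asym uv) w∈N⁺[v]

  d⁺<d⁺[N⁻∖N⁺⁺] : ∀ {v u} → inN⁻∖N⁺⁺ v u ≡ true → d⁺ T v < d⁺ T u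
  d⁺<d⁺[N⁻∖N⁺⁺] {v} {u} e = subst (_≤ d⁺ T u) count-N⁺[ v ] (count-mono λ w → N⁻∖N⁺⁺-dominates-N⁺[ v ] {w = w} e)

  1+d⁺<d⁺[N⁻∖N⁺⁺-arc] : ∀ {v u u′} → inN⁻∖N⁺⁺ v u ≡ true → inN⁻∖N⁺⁺ v u′ ≡ true →
                        adj T u u′ ≡ true → suc (d⁺ T v) < d⁺ T u
  1+d⁺<d⁺[N⁻∖N⁺⁺-arc] {v} {u} {u′} e e′ uu′ =
    subst (_≤ d⁺ T u) (trans (count-insert u′ u′∉N⁺[v]) (cong suc count-N⁺[ v ])) (count-mono dominated)
    where
    u′v : adj T u′ v ≡ true
    u′v = proj₁ (inN⁻∖N⁺⁺⁻ e′)
    u′∉N⁺[v] : inN⁺[ v ] u′ ≡ false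
    u′∉N⁺[v] rewrite dec-false (u′ ≟ v) (λ { refl → not-¬ (irrefl T v) u′v }) = adj-asym u′v
    dominated : ∀ w → does (w ≟ u′) ∨ inN⁺[ v ] w ≡ true → adj T u w ≡ true
    dominated w w∈ with w ≟ u′
    ... | yes refl = uu′
    ... | no _     = N⁻∖N⁺⁺-dominates-N⁺[ v ] e w∈

  TwoKing⇔N⁻∖N⁺⁺≡∅ : ∀ v → TwoKing T v ⇔ (∀ u → inN⁻∖N⁺⁺ v u ≡ false)
  TwoKing⇔N⁻∖N⁺⁺≡∅ v = mk⇔ to from
    where
    to : TwoKing T v → ∀ u → inN⁻∖N⁺⁺ v u ≡ false
    to king u with king u
    ... | inj₁ refl        = cong (_∧ not (inN⁺⁺ T v u)) (irrefl T v)
    ... | inj₂ (inj₁ vu)   = cong (_∧ not (inN⁺⁺ T v u)) (adj-asym vu)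
    ... | inj₂ (inj₂ u∈N⁺⁺) = trans (cong (λ b → adj T u v ∧ not b) u∈N⁺⁺) (∧-zeroʳ _)
    from : (∀ u → inN⁻∖N⁺⁺ v u ≡ false) → TwoKing T v
    from empty u with u ≟ v
    ... | yes u≡v = inj₁ u≡v
    ... | no u≢v with tour T v u (u≢v ∘ sym)
    ... | inj₁ (vu , _) = inj₂ (inj₁ vu)
    ... | inj₂ (_ , uv) =
      inj₂ (inj₂ (not-injective (subst (λ b → b ∧ not (inN⁺⁺ T v u) ≡ false) uv (empty u))))

  |N⁻∖N⁺⁺|≡0⇒d⁺⁺≡d⁻ : ∀ {v} → count (inN⁻∖N⁺⁺ v) ≡ 0 → d⁺⁺ T v ≡ d⁻ T v
  |N⁻∖N⁺⁺|≡0⇒d⁺⁺≡d⁻ {v} empty =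
    trans (sym (+-identityʳ _)) (trans (cong (_+_ (d⁺⁺ T v)) (sym empty)) (sym (d⁻≡d⁺⁺+|N⁻∖N⁺⁺| v)))

  |N⁻∖N⁺⁺|≡1⇒1+d⁺⁺≡d⁻ : ∀ {v} → count (inN⁻∖N⁺⁺ v) ≡ 1 → suc (d⁺⁺ T v) ≡ d⁻ T v
  |N⁻∖N⁺⁺|≡1⇒1+d⁺⁺≡d⁻ {v} single =
    trans (+-comm 1 _) (trans (cong (_+_ (d⁺⁺ T v)) (sym single)) (sym (d⁻≡d⁺⁺+|N⁻∖N⁺⁺| v)))

module _ {d : ℕ} (T : Tournament (2 * d)) where

  d⁺≡d⇒1+d⁻≡d : ∀ {v} → d⁺ T v ≡ d → suc (d⁻ T v) ≡ d
  d⁺≡d⇒1+d⁻≡d {v} = 1+m+n≡2*d⇒m≡d⇒1+n≡d (1+d⁺+d⁻≡n T v)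

  d⁻≡d⇒1+d⁺≡d : ∀ {v} → d⁻ T v ≡ d → suc (d⁺ T v) ≡ d
  d⁻≡d⇒1+d⁺≡d {v} = 1+m+n≡2*d⇒m≡d⇒1+n≡d (trans (cong suc (+-comm (d⁻ T v) (d⁺ T v))) (1+d⁺+d⁻≡n T v))

  TwoKing⇒gap≡1 : ∀ {v} → TwoKing T v → d⁻ T v ≡ d → gap T v ≡ + 1
  TwoKing⇒gap≡1 {v} king d⁻≡d = begin
    gap T v               ≡⟨ m-n≡m⊖n (d⁺⁺ T v) (d⁺ T v) ⟩
    d⁺⁺ T v ⊖ d⁺ T v      ≡⟨ cong (_⊖ d⁺ T v) d⁺⁺≡1+d⁺ ⟩
    suc (d⁺ T v) ⊖ d⁺ T v ≡⟨ 1+m⊖m≡1 (d⁺ T v) ⟩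
    + 1                   ∎
    where
    open ≡-Reasoning
    d⁺⁺≡1+d⁺ : d⁺⁺ T v ≡ suc (d⁺ T v)
    d⁺⁺≡1+d⁺ = begin
      d⁺⁺ T v      ≡⟨ |N⁻∖N⁺⁺|≡0⇒d⁺⁺≡d⁻ T (count-false (Equivalence.to (TwoKing⇔N⁻∖N⁺⁺≡∅ T v) king)) ⟩
      d⁻ T v       ≡⟨ d⁻≡d ⟩
      d            ≡⟨ d⁻≡d⇒1+d⁺≡d d⁻≡d ⟨
      suc (d⁺ T v) ∎

  module _ (almostRegular : AlmostRegular T) where

    d⁺≡d⊎d⁻≡d : ∀ v → d⁺ T v ≡ d ⊎ d⁻ T v ≡ d
    d⁺≡d⊎d⁻≡d v = |m-n|≡1⇒m≡d⊎n≡d (almostRegular v) (1+d⁺+d⁻≡n T v)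

    d⁺≤d : ∀ u → d⁺ T u ≤ d
    d⁺≤d u with d⁺≡d⊎d⁻≡d u
    ... | inj₁ d⁺≡d = ≤-reflexive d⁺≡d
    ... | inj₂ d⁻≡d = ≤-trans (n≤1+n _) (≤-reflexive (d⁻≡d⇒1+d⁺≡d d⁻≡d))

    d⁺≡d⇒N⁻∖N⁺⁺≡∅ : ∀ {v} → d⁺ T v ≡ d → ∀ u → inN⁻∖N⁺⁺ T v u ≡ false
    d⁺≡d⇒N⁻∖N⁺⁺≡∅ {v} d⁺≡d u with inN⁻∖N⁺⁺ T v u in e
    ... | true  = ⊥-elim (<-irrefl d⁺≡d (≤-trans (d⁺<d⁺[N⁻∖N⁺⁺] T e) (d⁺≤d u)))
    ... | false = refl

    1+d⁺≡d⇒|N⁻∖N⁺⁺|≤1 : ∀ {v} → suc (d⁺ T v) ≡ d → count (inN⁻∖N⁺⁺ T v) ≤ 1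
    1+d⁺≡d⇒|N⁻∖N⁺⁺|≤1 {v} 1+d⁺≡d = count≤1 unique
      where
      unique : ∀ x y → inN⁻∖N⁺⁺ T v x ≡ true → inN⁻∖N⁺⁺ T v y ≡ true → x ≡ y
      unique x y ex ey with x ≟ y
      ... | yes x≡y = x≡y
      ... | no x≢y with tour T x y x≢y
      ... | inj₁ (xy , _) = ⊥-elim (<-irrefl 1+d⁺≡d (≤-trans (1+d⁺<d⁺[N⁻∖N⁺⁺-arc] T ex ey xy) (d⁺≤d x)))
      ... | inj₂ (_ , yx) = ⊥-elim (<-irrefl 1+d⁺≡d (≤-trans (1+d⁺<d⁺[N⁻∖N⁺⁺-arc] T ey ex yx) (d⁺≤d y)))

    d⁺≡d⇒gap≡-1 : ∀ {v} → d⁺ T v ≡ d → gap T v ≡ -[1+ 0 ]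
    d⁺≡d⇒gap≡-1 {v} d⁺≡d = begin
      gap T v                 ≡⟨ m-n≡m⊖n (d⁺⁺ T v) (d⁺ T v) ⟩
      d⁺⁺ T v ⊖ d⁺ T v        ≡⟨ cong (d⁺⁺ T v ⊖_) d⁺≡1+d⁺⁺ ⟩
      d⁺⁺ T v ⊖ suc (d⁺⁺ T v) ≡⟨ m⊖1+m≡-1 (d⁺⁺ T v) ⟩
      -[1+ 0 ]                ∎
      where
      open ≡-Reasoning
      d⁺≡1+d⁺⁺ : d⁺ T v ≡ suc (d⁺⁺ T v)
      d⁺≡1+d⁺⁺ = begin
        d⁺ T v        ≡⟨ d⁺≡d ⟩
        d             ≡⟨ d⁺≡d⇒1+d⁻≡d d⁺≡d ⟨
        suc (d⁻ T v)  ≡⟨ cong suc (|N⁻∖N⁺⁺|≡0⇒d⁺⁺≡d⁻ T (count-false (d⁺≡d⇒N⁻∖N⁺⁺≡∅ d⁺≡d))) ⟨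
        suc (d⁺⁺ T v) ∎

    ¬TwoKing⇒gap≡0 : ∀ {v} → ¬ TwoKing T v → d⁻ T v ≡ d → gap T v ≡ + 0
    ¬TwoKing⇒gap≡0 {v} ¬king d⁻≡d = begin
      gap T v           ≡⟨ m-n≡m⊖n (d⁺⁺ T v) (d⁺ T v) ⟩
      d⁺⁺ T v ⊖ d⁺ T v  ≡⟨ cong (_⊖ d⁺ T v) d⁺⁺≡d⁺ ⟩
      d⁺ T v ⊖ d⁺ T v   ≡⟨ n⊖n≡0 (d⁺ T v) ⟩
      + 0               ∎
      where
      open ≡-Reasoning
      |N⁻∖N⁺⁺|≢0 : count (inN⁻∖N⁺⁺ T v) ≢ 0
      |N⁻∖N⁺⁺|≢0 empty = ¬king (Equivalence.from (TwoKing⇔N⁻∖N⁺⁺≡∅ T v) (count≡0⇒false empty))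
      |N⁻∖N⁺⁺|≡1 : count (inN⁻∖N⁺⁺ T v) ≡ 1
      |N⁻∖N⁺⁺|≡1 = ≤-antisym (1+d⁺≡d⇒|N⁻∖N⁺⁺|≤1 (d⁻≡d⇒1+d⁺≡d d⁻≡d)) (n≢0⇒n>0 |N⁻∖N⁺⁺|≢0)
      d⁺⁺≡d⁺ : d⁺⁺ T v ≡ d⁺ T v
      d⁺⁺≡d⁺ = suc-injective (begin
        suc (d⁺⁺ T v) ≡⟨ |N⁻∖N⁺⁺|≡1⇒1+d⁺⁺≡d⁻ T |N⁻∖N⁺⁺|≡1 ⟩
        d⁻ T v        ≡⟨ d⁻≡d ⟩
        d             ≡⟨ d⁻≡d⇒1+d⁺≡d d⁻≡d ⟨
        suc (d⁺ T v)  ∎)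

proposition4p9 : (d : ℕ) (T : Tournament (2 * d)) → AlmostRegular T →
    ∀ v →
      ((TwoKing T v × d⁻ T v ≡ d) → gap T v ≡ + 1) ×
      (d⁺ T v ≡ d → gap T v ≡ -[1+ 0 ]) ×
      (¬ (TwoKing T v × d⁻ T v ≡ d) → ¬ (d⁺ T v ≡ d) → gap T v ≡ + 0)
proposition4p9 d T almostRegular v =
    (λ (king , d⁻≡d) → TwoKing⇒gap≡1 T king d⁻≡d)
  , d⁺≡d⇒gap≡-1 T almostRegular
  , λ ¬king∧d⁻≡d d⁺≢d →
      [ ⊥-elim ∘ d⁺≢d
      , (λ d⁻≡d → ¬TwoKing⇒gap≡0 T almostRegular (λ king → ¬king∧d⁻≡d (king , d⁻≡d)) d⁻≡d)
      ] (d⁺≡d⊎d⁻≡d T almostRegular v)
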